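{- Let $\vec C$ be an orientation of the cycle $C_4$. If $G$ is a graph with $m(G)<m_2(C_4)$, then $G\not\to\vec C$, i.e., $G$ has an orientation containing no copy of $\vec C$.
   Context: $m(G)=\max\{e(J)/v(J):J\subseteq G,\ v(J)\ge1\}$ and $m_2(G)=\max\{(e(J)-1)/(v(J)-2):J\subseteq G,\ v(J)\ge3\}$; in particular $m_2(C_4)=3/2$. -}

module Defs where

open import Data.Nat using (ℕ; zero; suc; _+_; _*_; _<_; _≤_; _<ᵇ_)
open import Data.Fin using (Fin; zero; suc; toℕ)
open import Data.Bool using (Bool; true; false; _∧_; if_then_else_)
open import Data.Product using (_×_; Σ; ∃; _,_)
open import Data.Sum using (_⊎_)
open import Relation.Binary.PropositionalEquality using (_≡_)
open import Function.Definitions using (Injective)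

sumFin : (n : ℕ) → (Fin n → ℕ) → ℕ
sumFin zero    f = 0
sumFin (suc n) f = f zero + sumFin n (λ i → f (suc i))

record Graph : Set where
  field
    n     : ℕ
    adj   : Fin n → Fin n → Bool
    sym   : ∀ u v → adj u v ≡ adj v u
    irrfl : ∀ u → adj u u ≡ false
open Graph public

record Subgraph (G : Graph) : Set where
  field
    S      : Fin (n G) → Bool
    E      : Fin (n G) → Fin (n G) → Bool
    E-sym  : ∀ u v → E u v ≡ E v u
    E-adj  : ∀ u v → E u v ≡ true → adj G u v ≡ true
    E-left : ∀ u v → E u v ≡ true → S u ≡ true
open Subgraph public

boolToℕ : Bool → ℕ
boolToℕ true  = 1
boolToℕ false = 0

vJ : {G : Graph} → Subgraph G → ℕ
vJ {G} J = sumFin (n G) (λ u → boolToℕ (S J u))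

eJ : {G : Graph} → Subgraph G → ℕ
eJ {G} J = sumFin (n G) (λ u → sumFin (n G) (λ v →
             boolToℕ ((toℕ u <ᵇ toℕ v) ∧ E J u v)))

-- m(G) < 3/2  (= m₂(C₄)), i.e. e(J)/v(J) < 3/2 for every subgraph J with
-- v(J) ≥ 1; written with cleared denominators: 2·e(J) < 3·v(J).
mBelow3/2 : Graph → Set
mBelow3/2 G = (J : Subgraph G) → 1 ≤ vJ J → 2 * eJ J < 3 * vJ J

record Orientation (G : Graph) : Set where
  field
    arc      : Fin (n G) → Fin (n G) → Bool
    arc-adj  : ∀ u v → arc u v ≡ true → adj G u v ≡ true
    arc-asym : ∀ u v → arc u v ≡ true → arc v u ≡ false
    arc-tot  : ∀ u v → adj G u v ≡ true → (arc u v ≡ true) ⊎ (arc v u ≡ true)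
open Orientation public

-- The cycle C₄ on Fin 4 with edges {i, i+1 mod 4}.
next : Fin 4 → Fin 4
next zero                   = suc zero
next (suc zero)             = suc (suc zero)
next (suc (suc zero))       = suc (suc (suc zero))
next (suc (suc (suc zero))) = zero

-- An orientation of C₄: for edge {i, next i}, true means the arc i → next i,
-- false means next i → i.
OrientedC4 : Set
OrientedC4 = Fin 4 → Bool

ContainsCopy : {G : Graph} → Orientation G → OrientedC4 → Set
ContainsCopy {G} D C =
  Σ (Fin 4 → Fin (n G)) λ f → Injective _≡_ _≡_ f ×
    (∀ i → (if C i then arc D (f i) (f (next i)) else arc D (f (next i)) (f i)) ≡ true)

{-# OPTIONS --safe #-}
-- Since m(G) < 3/2, every nonempty vertex set A contains a vertex v with at most
-- two neighbours x, y in A.  Orient A ∖ v without a copy of C by induction.  A copy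
-- through v must use both edges vx, vy and a common neighbour w of x and y, and
-- whether it is a copy depends only on the directions of vx, vy, wx, wy.  A finite
-- check over all orientations C shows that vx and vy can always be directed so that
-- no pattern (wx, wy) occurring in A ∖ v completes a copy, unless two common
-- neighbours w₁, w₂ with different patterns already form a copy x w₁ y w₂ in A ∖ v.
module Submission where

open import Defs hiding (sym)
open import Algebra.Properties.CommutativeSemigroup using (interchange)
open import Data.Bool using (Bool; true; false; _∧_; not; if_then_else_)
open import Data.Bool.Properties using (∧-comm; ∧-zeroʳ; ∧-identityʳ; not-involutive)
  renaming (_≟_ to _≟ᵇ_)
open import Data.Fin using (Fin; zero; suc; toℕ; _≟_; _<?_)
open import Data.Fin.Patterns using (0F; 1F; 2F; 3F)
open import Data.Fin.Properties using (any?; all?; <-cmp)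
open import Data.List using ([]; _∷_; length; map)
open import Data.List.Properties using (length-map)
open import Data.List.Membership.Propositional using (_∈_)
open import Data.List.Membership.Propositional.Properties using (∈-map⁺)
open import Data.List.Relation.Unary.Any using (here; there)
open import Data.Nat using (ℕ; zero; suc; _+_; _*_; _≤_; _<_; _<ᵇ_; z≤n; s≤s; _≤?_)
open import Data.Nat.Properties
  using (+-mono-≤; *-zeroʳ; *-distribˡ-+; +-suc; +-identityʳ; suc-injective; 0≢1+n;
         <⇒≱; ≰⇒>; <ᵇ-reflects-<; +-commutativeSemigroup; module ≤-Reasoning)
open import Data.Empty using (⊥; ⊥-elim)
open import Data.Product using (Σ; ∃; ∃₂; _×_; _,_; proj₁; proj₂)
open import Data.Sum using (_⊎_; inj₁; inj₂; [_,_]′)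
open import Function using (_∘_; id)
open import Function.Definitions using (Injective)
open import Relation.Binary.Definitions using (tri<; tri≈; tri>)
open import Relation.Binary.PropositionalEquality
open import Relation.Nullary using (Dec; yes; no; does; _because_; ¬_; contradiction)
open import Relation.Nullary.Decidable
  using (from-yes; dec-true; dec-false; _×-dec_; _⊎-dec_; _→-dec_; ¬?)

∧-true⁻ : ∀ {x y} → x ∧ y ≡ true → x ≡ true × y ≡ true
∧-true⁻ {true} {true} _ = refl , refl
∧-true⁻ {true} {false} ()
∧-true⁻ {false} ()

∧-true⁺ : ∀ {x y} → x ≡ true → y ≡ true → x ∧ y ≡ true
∧-true⁺ refl refl = refl

does-true : ∀ {P : Set} (P? : Dec P) → does P? ≡ true → P
does-true (yes p) _ = p
does-true (no _) ()

sumFin-cong : ∀ n {f g : Fin n → ℕ} → (∀ i → f i ≡ g i) → sumFin n f ≡ sumFin n g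
sumFin-cong zero    eq = refl
sumFin-cong (suc n) eq = cong₂ _+_ (eq zero) (sumFin-cong n (eq ∘ suc))

sumFin-mono-≤ : ∀ n {f g : Fin n → ℕ} → (∀ i → f i ≤ g i) → sumFin n f ≤ sumFin n g
sumFin-mono-≤ zero    le = z≤n
sumFin-mono-≤ (suc n) le = +-mono-≤ (le zero) (sumFin-mono-≤ n (le ∘ suc))

sumFin-+ : ∀ n (f g : Fin n → ℕ) → sumFin n (λ i → f i + g i) ≡ sumFin n f + sumFin n g
sumFin-+ zero    f g = refl
sumFin-+ (suc n) f g =
  trans (cong (f zero + g zero +_) (sumFin-+ n (f ∘ suc) (g ∘ suc)))
        (interchange +-commutativeSemigroup (f zero) (g zero) _ _)

sumFin-* : ∀ n k (f : Fin n → ℕ) → sumFin n (λ i → k * f i) ≡ k * sumFin n f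
sumFin-* zero    k f = sym (*-zeroʳ k)
sumFin-* (suc n) k f =
  trans (cong (k * f zero +_) (sumFin-* n k (f ∘ suc))) (sym (*-distribˡ-+ k (f zero) _))

sumFin-zero : ∀ n → sumFin n (λ _ → 0) ≡ 0
sumFin-zero zero    = refl
sumFin-zero (suc n) = sumFin-zero n

sumFin-swap : ∀ n m (f : Fin n → Fin m → ℕ) →
  sumFin n (λ i → sumFin m (f i)) ≡ sumFin m (λ j → sumFin n (λ i → f i j))
sumFin-swap zero    m f = sym (sumFin-zero m)
sumFin-swap (suc n) m f =
  trans (cong (sumFin m (f zero) +_) (sumFin-swap n m (f ∘ suc))) (sym (sumFin-+ m (f zero) _))

count : ∀ {n} → (Fin n → Bool) → ℕ
count {n} P = sumFin n (λ i → boolToℕ (P i))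

count-true : ∀ n → count {n} (λ _ → true) ≡ n
count-true zero    = refl
count-true (suc n) = cong suc (count-true n)

remove : ∀ {n} → (Fin n → Bool) → Fin n → Fin n → Bool
remove P v w = if does (w ≟ v) then false else P w

remove-⊆ : ∀ {n} (P : Fin n → Bool) {v w} → remove P v w ≡ true → P w ≡ true
remove-⊆ P {v} {w} h with w ≟ v
... | no _ = h

remove-⊇ : ∀ {n} (P : Fin n → Bool) {v w} → P w ≡ true → w ≡ v ⊎ remove P v w ≡ true
remove-⊇ P {v} {w} Pw with w ≟ v
... | yes w≡v = inj₁ w≡v
... | no _    = inj₂ Pw

count-remove : ∀ {n} (P : Fin n → Bool) {v} → P v ≡ true → count P ≡ suc (count (remove P v))
count-remove {suc n} P {zero}  Pv rewrite Pv = refl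
count-remove {suc n} P {suc v} Pv =
  trans (cong (boolToℕ (P zero) +_) (count-remove (P ∘ suc) Pv)) (+-suc _ _)

covering : ∀ {n} (P : Fin n → Bool) →
  ∃ λ xs → length xs ≡ count P × (∀ {w} → P w ≡ true → w ∈ xs)
covering {zero} P = [] , refl , λ { {()} }
covering {suc n} P with covering (P ∘ suc) | P zero in P₀
... | xs , len , mem | true =
  zero ∷ map suc xs , cong suc (trans (length-map suc xs) len) ,
  λ { {zero} _ → here refl ; {suc w} Pw → there (∈-map⁺ suc (mem Pw)) }
... | xs , len , mem | false =
  map suc xs , trans (length-map suc xs) len ,
  λ { {zero} P₀′ → contradiction (trans (sym P₀) P₀′) λ () ; {suc w} Pw → ∈-map⁺ suc (mem Pw) }

coveredByTwo : ∀ {n} (P : Fin n → Bool) → Fin n → count P ≤ 2 →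
  ∃₂ λ x y → ∀ {w} → P w ≡ true → w ≡ x ⊎ w ≡ y
coveredByTwo P d small with covering P
... | xs , len , mem with pair xs (subst (_≤ 2) (sym len) small)
  where
  pair : ∀ xs → length xs ≤ 2 → ∃₂ λ x y → ∀ {w} → w ∈ xs → w ≡ x ⊎ w ≡ y
  pair []               _ = d , d , λ ()
  pair (x ∷ [])         _ = x , x , λ { (here e) → inj₁ e ; (there ()) }
  pair (x ∷ y ∷ [])     _ = x , y , λ { (here e) → inj₁ e ; (there (here e)) → inj₂ e ; (there (there ())) }
  pair (_ ∷ _ ∷ _ ∷ _) (s≤s (s≤s ()))
... | x , y , cover = x , y , cover ∘ mem

rotate : ℕ → Fin 4 → Fin 4
rotate zero    k = k
rotate (suc m) k = next (rotate m k)

_⊕_ : Fin 4 → Fin 4 → Fin 4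
i ⊕ k = rotate (toℕ i) k

rotate-next : ∀ m k → rotate m (next k) ≡ next (rotate m k)
rotate-next zero    k = refl
rotate-next (suc m) k = cong next (rotate-next m k)

next-injective : ∀ {k k′} → next k ≡ next k′ → k ≡ k′
next-injective {k} {k′} = from-yes (all? λ k → all? λ k′ → (next k ≟ next k′) →-dec (k ≟ k′)) k k′

rotate-injective : ∀ m {k k′} → rotate m k ≡ rotate m k′ → k ≡ k′
rotate-injective zero    eq = eq
rotate-injective (suc m) eq = rotate-injective m (next-injective eq)

⊕-next : ∀ i k → i ⊕ next k ≡ next (i ⊕ k)
⊕-next i = rotate-next (toℕ i)

⊕-zero : ∀ i → i ⊕ 0F ≡ i
⊕-zero = from-yes (all? λ i → i ⊕ 0F ≟ i)

⊕-inverse : ∀ i → ∃ λ j → ∀ k → i ⊕ (j ⊕ k) ≡ k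
⊕-inverse = from-yes (all? λ i → any? λ j → all? λ k → i ⊕ (j ⊕ k) ≟ k)

square : {A : Set} → A → A → A → A → Fin 4 → A
square p₀ p₁ p₂ p₃ 0F = p₀
square p₀ p₁ p₂ p₃ 1F = p₁
square p₀ p₁ p₂ p₃ 2F = p₂
square p₀ p₁ p₂ p₃ 3F = p₃

square-η : ∀ {A : Set} (f : Fin 4 → A) k → square (f 0F) (f 1F) (f 2F) (f 3F) k ≡ f k
square-η f 0F = refl
square-η f 1F = refl
square-η f 2F = refl
square-η f 3F = refl

square-injective : ∀ {A : Set} {p₀ p₁ p₂ p₃ : A} →
  p₀ ≢ p₁ → p₀ ≢ p₂ → p₀ ≢ p₃ → p₁ ≢ p₂ → p₁ ≢ p₃ → p₂ ≢ p₃ →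
  Injective _≡_ _≡_ (square p₀ p₁ p₂ p₃)
square-injective n₀₁ n₀₂ n₀₃ n₁₂ n₁₃ n₂₃ {0F} {0F} _ = refl
square-injective n₀₁ n₀₂ n₀₃ n₁₂ n₁₃ n₂₃ {0F} {1F} e = ⊥-elim (n₀₁ e)
square-injective n₀₁ n₀₂ n₀₃ n₁₂ n₁₃ n₂₃ {0F} {2F} e = ⊥-elim (n₀₂ e)
square-injective n₀₁ n₀₂ n₀₃ n₁₂ n₁₃ n₂₃ {0F} {3F} e = ⊥-elim (n₀₃ e)
square-injective n₀₁ n₀₂ n₀₃ n₁₂ n₁₃ n₂₃ {1F} {0F} e = ⊥-elim (n₀₁ (sym e))
square-injective n₀₁ n₀₂ n₀₃ n₁₂ n₁₃ n₂₃ {1F} {1F} _ = refl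
square-injective n₀₁ n₀₂ n₀₃ n₁₂ n₁₃ n₂₃ {1F} {2F} e = ⊥-elim (n₁₂ e)
square-injective n₀₁ n₀₂ n₀₃ n₁₂ n₁₃ n₂₃ {1F} {3F} e = ⊥-elim (n₁₃ e)
square-injective n₀₁ n₀₂ n₀₃ n₁₂ n₁₃ n₂₃ {2F} {0F} e = ⊥-elim (n₀₂ (sym e))
square-injective n₀₁ n₀₂ n₀₃ n₁₂ n₁₃ n₂₃ {2F} {1F} e = ⊥-elim (n₁₂ (sym e))
square-injective n₀₁ n₀₂ n₀₃ n₁₂ n₁₃ n₂₃ {2F} {2F} _ = refl
square-injective n₀₁ n₀₂ n₀₃ n₁₂ n₁₃ n₂₃ {2F} {3F} e = ⊥-elim (n₂₃ e)
square-injective n₀₁ n₀₂ n₀₃ n₁₂ n₁₃ n₂₃ {3F} {0F} e = ⊥-elim (n₀₃ (sym e))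
square-injective n₀₁ n₀₂ n₀₃ n₁₂ n₁₃ n₂₃ {3F} {1F} e = ⊥-elim (n₁₃ (sym e))
square-injective n₀₁ n₀₂ n₀₃ n₁₂ n₁₃ n₂₃ {3F} {2F} e = ⊥-elim (n₂₃ (sym e))
square-injective n₀₁ n₀₂ n₀₃ n₁₂ n₁₃ n₂₃ {3F} {3F} _ = refl

IsRotationOf : (Fin 4 → Bool) → OrientedC4 → Set
IsRotationOf P C = ∃ λ i → ∀ k → P k ≡ C (i ⊕ k)

isRotationOf? : ∀ P C → Dec (IsRotationOf P C)
isRotationOf? P C = any? λ i → all? λ k → P k ≟ᵇ C (i ⊕ k)

-- The bits a, b say whether v→x and v→y, and c, d whether w→x and w→y, for a
-- vertex v with neighbours x, y and a common neighbour w of x and y.  Bad says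
-- that the square v x w y, read from v in one of its two directions, is a copy of C.
Bad : OrientedC4 → Bool → Bool → Bool → Bool → Set
Bad C a b c d = IsRotationOf (square a (not c) d (not b)) C
              ⊎ IsRotationOf (square b (not d) c (not a)) C

bad? : ∀ C a b c d → Dec (Bad C a b c d)
bad? C a b c d = isRotationOf? _ C ⊎-dec isRotationOf? _ C

Bad-cong : ∀ {C C′ a b c d} → (∀ k → C k ≡ C′ k) → Bad C a b c d → Bad C′ a b c d
Bad-cong {C} {C′} C≗C′ = [ inj₁ ∘ rotated , inj₂ ∘ rotated ]′
  where
  rotated : ∀ {P} → IsRotationOf P C → IsRotationOf P C′
  rotated (i , eq) = i , λ k → trans (eq k) (C≗C′ (i ⊕ k))

-- s c d says that some common neighbour w of x and y has the bits (c , d).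
Compatible : OrientedC4 → (Bool → Bool → Bool) → Set
Compatible C s = ∀ c₁ d₁ c₂ d₂ → s c₁ d₁ ≡ true → s c₂ d₂ ≡ true →
  ¬ (c₁ ≡ c₂ × d₁ ≡ d₂) → ¬ Bad C c₁ d₁ c₂ d₂

Safe : OrientedC4 → (Bool → Bool → Bool) → Bool → Bool → Set
Safe C s a b = ∀ c d → s c d ≡ true → ¬ Bad C a b c d

∀-Bool? : {P : Bool → Set} → (∀ b → Dec (P b)) → Dec (∀ b → P b)
∀-Bool? P? with P? false | P? true
... | yes p | yes q = yes λ { false → p ; true → q }
... | no ¬p | _     = no λ h → ¬p (h false)
... | _     | no ¬q = no λ h → ¬q (h true)

∃-Bool? : {P : Bool → Set} → (∀ b → Dec (P b)) → Dec (∃ P)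
∃-Bool? P? with P? false | P? true
... | yes p | _     = yes (false , p)
... | _     | yes q = yes (true , q)
... | no ¬p | no ¬q = no λ { (false , p) → ¬p p ; (true , q) → ¬q q }

compatible? : ∀ C s → Dec (Compatible C s)
compatible? C s = ∀-Bool? λ c₁ → ∀-Bool? λ d₁ → ∀-Bool? λ c₂ → ∀-Bool? λ d₂ →
  (s c₁ d₁ ≟ᵇ true) →-dec (s c₂ d₂ ≟ᵇ true) →-dec
  ¬? ((c₁ ≟ᵇ c₂) ×-dec (d₁ ≟ᵇ d₂)) →-dec ¬? (bad? C c₁ d₁ c₂ d₂)

safe? : ∀ C s a b → Dec (Safe C s a b)
safe? C s a b = ∀-Bool? λ c → ∀-Bool? λ d → (s c d ≟ᵇ true) →-dec ¬? (bad? C a b c d)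

table : Bool → Bool → Bool → Bool → Bool → Bool → Bool
table t₀₀ t₀₁ t₁₀ t₁₁ false false = t₀₀
table t₀₀ t₀₁ t₁₀ t₁₁ false true  = t₀₁
table t₀₀ t₀₁ t₁₀ t₁₁ true  false = t₁₀
table t₀₀ t₀₁ t₁₀ t₁₁ true  true  = t₁₁

table-η : ∀ (s : Bool → Bool → Bool) c d →
  table (s false false) (s false true) (s true false) (s true true) c d ≡ s c d
table-η s false false = refl
table-η s false true  = refl
table-η s true  false = refl
table-η s true  true  = refl

-- Decided by evaluating all 2⁸ cases; kept opaque because unfolding the
-- decision procedure at use sites makes type checking very slow.
opaque
  safeDirections-table : ∀ c₀ c₁ c₂ c₃ t₀₀ t₀₁ t₁₀ t₁₁ →
    let C = square c₀ c₁ c₂ c₃ ; s = table t₀₀ t₀₁ t₁₀ t₁₁ in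
    Compatible C s → ∃₂ (Safe C s)
  safeDirections-table = from-yes
    (∀-Bool? λ c₀ → ∀-Bool? λ c₁ → ∀-Bool? λ c₂ → ∀-Bool? λ c₃ →
     ∀-Bool? λ t₀₀ → ∀-Bool? λ t₀₁ → ∀-Bool? λ t₁₀ → ∀-Bool? λ t₁₁ →
     let C = square c₀ c₁ c₂ c₃ ; s = table t₀₀ t₀₁ t₁₀ t₁₁ in
     compatible? C s →-dec ∃-Bool? λ a → ∃-Bool? λ b → safe? C s a b)

opaque
  safeDirections : ∀ C s → ∃₂ λ a b → Compatible C s → Safe C s a b
  safeDirections C s with compatible? C s
  ... | no incompatible = true , true , λ compatible → contradiction compatible incompatible
  ... | yes compatible
    with safeDirections-table (C 0F) (C 1F) (C 2F) (C 3F)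
           (s false false) (s false true) (s true false) (s true true)
           (λ c₁ d₁ c₂ d₂ s₁ s₂ distinct bad →
              compatible c₁ d₁ c₂ d₂ (trans (sym (table-η s c₁ d₁)) s₁) (trans (sym (table-η s c₂ d₂)) s₂)
                         distinct (Bad-cong (square-η C) bad))
  ... | a , b , safe = a , b , λ _ c d scd bad →
    safe c d (trans (table-η s c d) scd) (Bad-cong (sym ∘ square-η C) bad)

-- Orientations are built as tournaments, directing every pair of distinct
-- vertices, so that redirecting the pairs at one vertex need not know which
-- pairs are edges; inducedOrientation restricts a tournament to the edges of G.
record Tournament (N : ℕ) : Set where
  field
    beats      : Fin N → Fin N → Bool
    beats-flip : ∀ {u w} → u ≢ w → beats w u ≡ not (beats u w)
open Tournament public

byIndex : ∀ N → Tournament N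
byIndex N = record { beats = λ u w → does (u <? w) ; beats-flip = flip }
  where
  flip : ∀ {u w : Fin N} → u ≢ w → does (w <? u) ≡ not (does (u <? w))
  flip {u} {w} u≢w with <-cmp u w
  ... | tri< u<w _ w≮u = trans (dec-false (w <? u) w≮u) (cong not (sym (dec-true (u <? w) u<w)))
  ... | tri≈ _ u≡w _   = ⊥-elim (u≢w u≡w)
  ... | tri> u≮w _ w<u = trans (dec-true (w <? u) w<u) (cong not (sym (dec-false (u <? w) u≮w)))

module _ {N} (T : Tournament N) (v : Fin N) (σ : Fin N → Bool) where

  redirectBeats : Fin N → Fin N → Bool
  redirectBeats u w = if does (u ≟ v) then σ w else if does (w ≟ v) then not (σ u) else beats T u w

  redirect-from : ∀ w → redirectBeats v w ≡ σ w
  redirect-from w rewrite dec-true (v ≟ v) refl = refl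

  redirect-to : ∀ {u} → u ≢ v → redirectBeats u v ≡ not (σ u)
  redirect-to {u} u≢v rewrite dec-false (u ≟ v) u≢v | dec-true (v ≟ v) refl = refl

  redirect-away : ∀ {u w} → u ≢ v → w ≢ v → redirectBeats u w ≡ beats T u w
  redirect-away {u} {w} u≢v w≢v rewrite dec-false (u ≟ v) u≢v | dec-false (w ≟ v) w≢v = refl

  redirect : Tournament N
  redirect = record { beats = redirectBeats ; beats-flip = flip }
    where
    flip : ∀ {u w} → u ≢ w → redirectBeats w u ≡ not (redirectBeats u w)
    flip {u} {w} u≢w = cases (u ≟ v) (w ≟ v)
      where
      cases : Dec (u ≡ v) → Dec (w ≡ v) → redirectBeats w u ≡ not (redirectBeats u w)
      cases (yes u≡v) (yes w≡v) = ⊥-elim (u≢w (trans u≡v (sym w≡v)))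
      cases (yes u≡v) (no w≢v)  = subst (λ z → redirectBeats w z ≡ not (redirectBeats z w)) (sym u≡v)
        (trans (redirect-to w≢v) (cong not (sym (redirect-from w))))
      cases (no u≢v)  (yes w≡v) = subst (λ z → redirectBeats z u ≡ not (redirectBeats u z)) (sym w≡v)
        (trans (redirect-from u) (sym (trans (cong not (redirect-to u≢v)) (not-involutive (σ u)))))
      cases (no u≢v)  (no w≢v)  =
        trans (redirect-away w≢v u≢v) (trans (beats-flip T u≢w) (cong not (sym (redirect-away u≢v w≢v))))

module _ (G : Graph) where

  private
    N : ℕ
    N = n G

    V : Set
    V = Fin N

  adj⇒≢ : ∀ {u w} → adj G u w ≡ true → u ≢ w
  adj⇒≢ {u} u~u refl = contradiction (trans (sym (irrfl G u)) u~u) λ ()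

  induced : (V → Bool) → Subgraph G
  induced A = record
    { S      = A
    ; E      = λ u w → adj G u w ∧ (A u ∧ A w)
    ; E-sym  = λ u w → cong₂ _∧_ (Graph.sym G u w) (∧-comm (A u) (A w))
    ; E-adj  = λ u w → proj₁ ∘ ∧-true⁻
    ; E-left = λ u w → proj₁ ∘ ∧-true⁻ ∘ proj₂ ∘ ∧-true⁻ {adj G u w} }

  handshake : (J : Subgraph G) → sumFin N (λ u → sumFin N (λ w → boolToℕ (E J u w))) ≡ 2 * eJ J
  handshake J = begin
    sumFin N (λ u → sumFin N (λ w → boolToℕ (E J u w)))
      ≡⟨ sumFin-cong N (λ u → trans (sumFin-cong N (split u)) (sumFin-+ N _ _)) ⟩
    sumFin N (λ u → sumFin N (λ w → boolToℕ (before u w ∧ E J u w))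
                  + sumFin N (λ w → boolToℕ (before w u ∧ E J u w)))
      ≡⟨ sumFin-+ N _ _ ⟩
    eJ J + sumFin N (λ u → sumFin N (λ w → boolToℕ (before w u ∧ E J u w)))
      ≡⟨ cong (eJ J +_) (trans (sumFin-swap N N _) (sumFin-cong N λ w → sumFin-cong N λ u →
           cong (λ e → boolToℕ (before w u ∧ e)) (E-sym J u w))) ⟩
    eJ J + eJ J
      ≡⟨ cong (eJ J +_) (sym (+-identityʳ (eJ J))) ⟩
    2 * eJ J ∎
    where
    open ≡-Reasoning
    before : V → V → Bool
    before u w = toℕ u <ᵇ toℕ w
    before? : ∀ u w → Dec (toℕ u < toℕ w)
    before? u w = before u w because <ᵇ-reflects-< (toℕ u) (toℕ w)
    split : ∀ u w → boolToℕ (E J u w) ≡ boolToℕ (before u w ∧ E J u w) + boolToℕ (before w u ∧ E J u w)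
    split u w with E J u w in uw
    ... | false rewrite ∧-zeroʳ (before u w) | ∧-zeroʳ (before w u) = refl
    ... | true rewrite ∧-identityʳ (before u w) | ∧-identityʳ (before w u) with <-cmp u w
    ...   | tri< u<w _ w≮u rewrite dec-true (before? u w) u<w | dec-false (before? w u) w≮u = refl
    ...   | tri> u≮w _ w<u rewrite dec-false (before? u w) u≮w | dec-true (before? w u) w<u = refl
    ...   | tri≈ _ u≡w _   = ⊥-elim (adj⇒≢ (E-adj J u w uw) u≡w)

  degree : (V → Bool) → V → ℕ
  degree A v = count (λ w → adj G v w ∧ A w)

  minDegree3⇒dense : ∀ A → (∀ v → A v ≡ true → 3 ≤ degree A v) →
    3 * vJ (induced A) ≤ 2 * eJ (induced A)
  minDegree3⇒dense A deg≥3 = begin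
    3 * count A                                                       ≡⟨ sym (sumFin-* N 3 _) ⟩
    sumFin N (λ u → 3 * boolToℕ (A u))                                ≤⟨ sumFin-mono-≤ N row ⟩
    sumFin N (λ u → sumFin N (λ w → boolToℕ (E (induced A) u w)))     ≡⟨ handshake (induced A) ⟩
    2 * eJ (induced A)                                                ∎
    where
    open ≤-Reasoning
    row : ∀ u → 3 * boolToℕ (A u) ≤ sumFin N (λ w → boolToℕ (adj G u w ∧ (A u ∧ A w)))
    row u with A u in Au
    ... | true  = deg≥3 u Au
    ... | false = z≤n

  lowDegreeVertex : mBelow3/2 G → ∀ A → 1 ≤ count A → ∃ λ v → A v ≡ true × degree A v ≤ 2
  lowDegreeVertex sparse A nonempty with any? (λ v → (A v ≟ᵇ true) ×-dec (degree A v ≤? 2))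
  ... | yes found = found
  ... | no none   = ⊥-elim (<⇒≱ (sparse (induced A) nonempty)
                                 (minDegree3⇒dense A λ v Av → ≰⇒> λ low → none (v , Av , low)))

  record IsCopy (T : Tournament N) (C : OrientedC4) (f : Fin 4 → V) : Set where
    field
      injective : Injective _≡_ _≡_ f
      adjacent  : ∀ k → adj G (f k) (f (next k)) ≡ true
      directed  : ∀ k → beats T (f k) (f (next k)) ≡ C k

  CopyFreeOn : Tournament N → OrientedC4 → (V → Bool) → Set
  CopyFreeOn T C A = ∀ f → IsCopy T C f → (∀ k → A (f k) ≡ true) → ⊥

  IsCopy-cong : ∀ {T C C′ f} → (∀ k → C k ≡ C′ k) → IsCopy T C f → IsCopy T C′ f
  IsCopy-cong C≗C′ copy = record
    { injective = injective ; adjacent = adjacent ; directed = λ k → trans (directed k) (C≗C′ k) }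
    where open IsCopy copy

  IsCopy-rotate : ∀ {T C f} i → IsCopy T C f → IsCopy T (λ k → C (i ⊕ k)) (λ k → f (i ⊕ k))
  IsCopy-rotate {T} {C} {f} i copy = record
    { injective = rotate-injective (toℕ i) ∘ injective
    ; adjacent  = λ k → subst (λ j → adj G (f (i ⊕ k)) (f j) ≡ true) (sym (⊕-next i k)) (adjacent (i ⊕ k))
    ; directed  = λ k → subst (λ j → beats T (f (i ⊕ k)) (f j) ≡ C (i ⊕ k)) (sym (⊕-next i k)) (directed (i ⊕ k))
    }
    where open IsCopy copy

  CopyFreeOn-rotation : ∀ {T C A P g} → CopyFreeOn T C A → IsCopy T P g → (∀ k → A (g k) ≡ true) →
    ¬ IsRotationOf P C
  CopyFreeOn-rotation {C = C} free copy inA (i , P≗) with ⊕-inverse i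
  ... | j , inverse =
    free _ (IsCopy-cong (λ k → trans (P≗ (j ⊕ k)) (cong C (inverse k))) (IsCopy-rotate j copy)) (inA ∘ (j ⊕_))

  CommonNeighbour : (V → Bool) → V → V → V → Set
  CommonNeighbour A p q w = A w ≡ true × adj G w p ≡ true × adj G w q ≡ true

  commonNeighbour? : ∀ A p q w → Dec (CommonNeighbour A p q w)
  commonNeighbour? A p q w = (A w ≟ᵇ true) ×-dec (adj G w p ≟ᵇ true) ×-dec (adj G w q ≟ᵇ true)

  CommonNeighbour-swap : ∀ {A p q w} → CommonNeighbour A p q w → CommonNeighbour A q p w
  CommonNeighbour-swap (Aw , wp , wq) = Aw , wq , wp

  CopyFreeOn-square : ∀ {T C A p q w₁ w₂} → CopyFreeOn T C A → p ≢ q → w₁ ≢ w₂ →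
    A p ≡ true → A q ≡ true → CommonNeighbour A p q w₁ → CommonNeighbour A p q w₂ →
    ¬ IsRotationOf (square (beats T w₁ p) (not (beats T w₂ p)) (beats T w₂ q) (not (beats T w₁ q))) C
  CopyFreeOn-square {T} {A = A} {p = p} {q} {w₁} {w₂} free p≢q w₁≢w₂ Ap Aq (Aw₁ , w₁p , w₁q) (Aw₂ , w₂p , w₂q) =
    CopyFreeOn-rotation {A = A} free copy inA
    where
    p-w₂ : adj G p w₂ ≡ true
    p-w₂ = trans (Graph.sym G p w₂) w₂p
    q-w₁ : adj G q w₁ ≡ true
    q-w₁ = trans (Graph.sym G q w₁) w₁q
    copy : IsCopy T (square (beats T w₁ p) (not (beats T w₂ p)) (beats T w₂ q) (not (beats T w₁ q)))
                    (square w₁ p w₂ q)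
    copy = record
      { injective = square-injective (adj⇒≢ w₁p) w₁≢w₂ (adj⇒≢ w₁q) (adj⇒≢ p-w₂) p≢q (adj⇒≢ w₂q)
      ; adjacent  = λ { 0F → w₁p ; 1F → p-w₂ ; 2F → w₂q ; 3F → q-w₁ }
      ; directed  = λ { 0F → refl
                      ; 1F → beats-flip T (adj⇒≢ w₂p)
                      ; 2F → refl
                      ; 3F → beats-flip T (adj⇒≢ w₁q) } }
    inA : ∀ k → A (square w₁ p w₂ q k) ≡ true
    inA 0F = Aw₁
    inA 1F = Ap
    inA 2F = Aw₂
    inA 3F = Aq

  inducedOrientation : Tournament N → Orientation G
  inducedOrientation T = record
    { arc      = λ u w → adj G u w ∧ beats T u w
    ; arc-adj  = λ u w → proj₁ ∘ ∧-true⁻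
    ; arc-asym = asym
    ; arc-tot  = tot }
    where
    asym : ∀ u w → adj G u w ∧ beats T u w ≡ true → adj G w u ∧ beats T w u ≡ false
    asym u w uw→ with ∧-true⁻ {adj G u w} uw→
    ... | uw , u→w rewrite beats-flip T (adj⇒≢ uw) | u→w = ∧-zeroʳ (adj G w u)
    tot : ∀ u w → adj G u w ≡ true → adj G u w ∧ beats T u w ≡ true ⊎ adj G w u ∧ beats T w u ≡ true
    tot u w uw with beats T u w in u→w
    ... | true  = inj₁ (∧-true⁺ uw refl)
    ... | false = inj₂ (∧-true⁺ (trans (Graph.sym G w u) uw) (trans (beats-flip T (adj⇒≢ uw)) (cong not u→w)))

  copyOf : ∀ {T C} → ContainsCopy (inducedOrientation T) C → ∃ (IsCopy T C)
  copyOf {T} {C} (f , injective , follows) =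
    f , record { injective = injective ; adjacent = proj₁ ∘ along ; directed = proj₂ ∘ along }
    where
    along : ∀ k → adj G (f k) (f (next k)) ≡ true × beats T (f k) (f (next k)) ≡ C k
    along k with C k | follows k
    ... | true  | k→ = ∧-true⁻ k→
    ... | false | ←k with ∧-true⁻ {adj G (f (next k)) (f k)} ←k
    ...   | adjacent , beaten =
      trans (Graph.sym G (f k) (f (next k))) adjacent ,
      trans (beats-flip T (adj⇒≢ adjacent)) (cong not beaten)

  module Extension (T : Tournament N) (C : OrientedC4) (A A′ : V → Bool) (v x y : V)
    (A⊆ : ∀ u → A u ≡ true → u ≡ v ⊎ A′ u ≡ true)
    (neighbours : ∀ w → adj G v w ≡ true → A′ w ≡ true → w ≡ x ⊎ w ≡ y)
    (free : CopyFreeOn T C A′) where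

    HasPattern : Bool → Bool → V → Set
    HasPattern c d w = CommonNeighbour A′ x y w × beats T w x ≡ c × beats T w y ≡ d

    hasPattern? : ∀ c d w → Dec (HasPattern c d w)
    hasPattern? c d w = commonNeighbour? A′ x y w ×-dec (beats T w x ≟ᵇ c) ×-dec (beats T w y ≟ᵇ d)

    patterns : Bool → Bool → Bool
    patterns c d = does (any? (hasPattern? c d))

    patterns⁺ : ∀ {w} → CommonNeighbour A′ x y w → patterns (beats T w x) (beats T w y) ≡ true
    patterns⁺ {w} nbr = dec-true (any? (hasPattern? _ _)) (w , nbr , refl , refl)

    patterns-compatible : x ≢ y → A′ x ≡ true → A′ y ≡ true → Compatible C patterns
    patterns-compatible x≢y A′x A′y c₁ d₁ c₂ d₂ s₁ s₂ distinct
      with does-true (any? (hasPattern? c₁ d₁)) s₁ | does-true (any? (hasPattern? c₂ d₂)) s₂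
    ... | w₁ , nbr₁ , refl , refl | w₂ , nbr₂ , refl , refl =
      [ CopyFreeOn-square free x≢y w₁≢w₂ A′x A′y nbr₁ nbr₂
      , CopyFreeOn-square free (x≢y ∘ sym) w₁≢w₂ A′y A′x (CommonNeighbour-swap {A′} nbr₁) (CommonNeighbour-swap {A′} nbr₂) ]′
      where
      w₁≢w₂ : w₁ ≢ w₂
      w₁≢w₂ refl = distinct (refl , refl)

    a b : Bool
    a = proj₁ (safeDirections C patterns)
    b = proj₁ (proj₂ (safeDirections C patterns))

    safe : Compatible C patterns → Safe C patterns a b
    safe = proj₂ (proj₂ (safeDirections C patterns))

    σ : V → Bool
    σ w = if does (w ≟ x) then a else b

    σ-x : σ x ≡ a
    σ-x rewrite dec-true (x ≟ x) refl = refl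

    σ-y : y ≢ x → σ y ≡ b
    σ-y y≢x rewrite dec-false (y ≟ x) y≢x = refl

    T′ : Tournament N
    T′ = redirect T v σ

    no-bad-square : ∀ {p q w} → (p ≡ x × q ≡ y) ⊎ (p ≡ y × q ≡ x) → p ≢ q →
      A′ p ≡ true → A′ q ≡ true → CommonNeighbour A′ p q w →
      ¬ IsRotationOf (square (σ p) (not (beats T w p)) (beats T w q) (not (σ q))) C
    no-bad-square (inj₁ (refl , refl)) x≢y A′x A′y nbr rotation =
      safe (patterns-compatible x≢y A′x A′y) _ _ (patterns⁺ nbr)
        (inj₁ (subst₂ (λ a′ b′ → IsRotationOf (square a′ _ _ (not b′)) C) σ-x (σ-y (x≢y ∘ sym)) rotation))
    no-bad-square (inj₂ (refl , refl)) y≢x A′y A′x nbr rotation =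
      safe (patterns-compatible (y≢x ∘ sym) A′x A′y) _ _ (patterns⁺ (CommonNeighbour-swap {A′} nbr))
        (inj₂ (subst₂ (λ b′ a′ → IsRotationOf (square b′ _ _ (not a′)) C) (σ-y y≢x) σ-x rotation))

    ends : ∀ {p q} → p ≢ q → p ≡ x ⊎ p ≡ y → q ≡ x ⊎ q ≡ y → (p ≡ x × q ≡ y) ⊎ (p ≡ y × q ≡ x)
    ends p≢q (inj₁ p≡x)  (inj₂ q≡y)  = inj₁ (p≡x , q≡y)
    ends p≢q (inj₂ p≡y)  (inj₁ q≡x)  = inj₂ (p≡y , q≡x)
    ends p≢q (inj₁ refl) (inj₁ refl) = ⊥-elim (p≢q refl)
    ends p≢q (inj₂ refl) (inj₂ refl) = ⊥-elim (p≢q refl)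

    through-v : ∀ {C′ g} → IsCopy T′ C′ g → g 0F ≡ v → (∀ k → A (g k) ≡ true) → ¬ IsRotationOf C′ C
    through-v {C′} {g} copy g₀≡v inA (i , rotation) =
      no-bad-square (ends p≢q (neighbour 1F (λ ()) v-p) (neighbour 3F (λ ()) v-q)) p≢q
        (inA′ 1F (λ ())) (inA′ 3F (λ ())) (inA′ 2F (λ ()) , w-p , adjacent 2F)
        (i , λ k → trans (sym (value k)) (rotation k))
      where
      open IsCopy copy
      p w q : V
      p = g 1F
      w = g 2F
      q = g 3F
      off-v : ∀ k → k ≢ 0F → g k ≢ v
      off-v k k≢0 gk≡v = k≢0 (injective (trans gk≡v (sym g₀≡v)))
      inA′ : ∀ k → k ≢ 0F → A′ (g k) ≡ true
      inA′ k k≢0 = [ ⊥-elim ∘ off-v k k≢0 , id ]′ (A⊆ (g k) (inA k))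
      neighbour : ∀ k → k ≢ 0F → adj G v (g k) ≡ true → g k ≡ x ⊎ g k ≡ y
      neighbour k k≢0 v-gk = neighbours (g k) v-gk (inA′ k k≢0)
      p≢q : p ≢ q
      p≢q = (λ ()) ∘ injective
      w≢p : w ≢ p
      w≢p = (λ ()) ∘ injective
      v-p : adj G v p ≡ true
      v-p = subst (λ u → adj G u p ≡ true) g₀≡v (adjacent 0F)
      v-q : adj G v q ≡ true
      v-q = subst (λ u → adj G u q ≡ true) g₀≡v (trans (Graph.sym G (g 0F) q) (adjacent 3F))
      w-p : adj G w p ≡ true
      w-p = trans (Graph.sym G w p) (adjacent 1F)
      value : ∀ k → C′ k ≡ square (σ p) (not (beats T w p)) (beats T w q) (not (σ q)) k
      value 0F = trans (sym (directed 0F))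
        (trans (cong (λ u → redirectBeats T v σ u p) g₀≡v) (redirect-from T v σ p))
      value 1F = trans (sym (directed 1F))
        (trans (redirect-away T v σ (off-v 1F λ ()) (off-v 2F λ ())) (beats-flip T w≢p))
      value 2F = trans (sym (directed 2F)) (redirect-away T v σ (off-v 2F λ ()) (off-v 3F λ ()))
      value 3F = trans (sym (directed 3F))
        (trans (cong (redirectBeats T v σ q) g₀≡v) (redirect-to T v σ (off-v 3F λ ())))

    redirect-free : CopyFreeOn T′ C A
    redirect-free f copy inA with any? (λ i → f i ≟ v)
    ... | yes (i , fᵢ≡v) =
      through-v (IsCopy-rotate i copy) (trans (cong f (⊕-zero i)) fᵢ≡v) (inA ∘ (i ⊕_)) (i , λ _ → refl)
    ... | no avoids = free f away (λ k → [ ⊥-elim ∘ avoid k , id ]′ (A⊆ (f k) (inA k)))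
      where
      open IsCopy copy
      avoid : ∀ k → f k ≢ v
      avoid k fₖ≡v = avoids (k , fₖ≡v)
      away : IsCopy T C f
      away = record
        { injective = injective
        ; adjacent  = adjacent
        ; directed  = λ k → trans (sym (redirect-away T v σ (avoid k) (avoid (next k)))) (directed k) }

  extend : ∀ T C (A A′ : V → Bool) v x y →
    (∀ u → A u ≡ true → u ≡ v ⊎ A′ u ≡ true) →
    (∀ w → adj G v w ≡ true → A′ w ≡ true → w ≡ x ⊎ w ≡ y) →
    CopyFreeOn T C A′ → ∃ λ σ → CopyFreeOn (redirect T v σ) C A
  extend T C A A′ v x y A⊆ neighbours free = σ , redirect-free
    where open Extension T C A A′ v x y A⊆ neighbours free

  orient : mBelow3/2 G → ∀ C k (A : V → Bool) → count A ≡ k → ∃ λ T → CopyFreeOn T C A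
  orient sparse C zero A empty =
    byIndex N , λ f _ inA → 0≢1+n (trans (sym empty) (count-remove A (inA 0F)))
  orient sparse C (suc k) A size
    with lowDegreeVertex sparse A (subst (1 ≤_) (sym size) (s≤s z≤n))
  ... | v , Av , low
    with coveredByTwo (λ w → adj G v w ∧ A w) v low
       | orient sparse C k (remove A v) (suc-injective (trans (sym (count-remove A Av)) size))
  ... | x , y , neighbours | T , free =
    let σ , free′ = extend T C A (remove A v) v x y (λ u → remove-⊇ A)
                      (λ w vw A′w → neighbours (∧-true⁺ vw (remove-⊆ A A′w))) free
    in redirect T v σ , free′

theorem22 : (C : OrientedC4) (G : Graph) → mBelow3/2 G →
    Σ (Orientation G) (λ D → ¬ ContainsCopy D C)
theorem22 C G sparse with orient G sparse C (n G) (λ _ → true) (count-true (n G))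
... | T , free = inducedOrientation G T , λ copy →
  let f , isCopy = copyOf G copy in free f isCopy (λ _ → refl)
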